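{- Let $\mathcal{A}$ be a strongly connected NFA with period $\lambda$ and periodicity classes $Q_0,\dots,Q_{\lambda-1}$. A $\lambda$-positional word $\tau=\langle i:u\rangle$ is a blocking factor for $\mathcal{A}$ if and only if for all states $p\in Q_i$ and $q\in Q$, there is no run of $\mathcal{A}$ from $p$ to $q$ labeled by $u$.
   Context: $\mathcal{A}=(Q,\Sigma,\delta,q_0,F)$ is a trim NFA whose underlying graph is strongly connected; its period $\lambda$ is the gcd of the lengths of its cycles. The periodicity classes are a partition $Q=Q_0\sqcup\cdots\sqcup Q_{\lambda-1}$ such that every path from a state of $Q_i$ to a state of $Q_j$ has length $\equiv j-i\pmod\lambda$, numbered so that $q_0\in Q_0$; indices are taken mod $\lambda$. A $\lambda$-positional word is a word over $(\mathbb{Z}/\lambda\mathbb{Z})\times\Sigma$ of the form $(n\bmod\lambda,a_0)((n+1)\bmod\lambda,a_1)\cdots((n+\ell)\bmod\lambda,a_\ell)$, written $\langle n:u\rangle$ with $u=a_0\cdots a_\ell$. The positional language is $\widehat L(\mathcal{A})=\{\langle 0:u\rangle : u\in L(\mathcal{A})\}$. A positional word $\tau$ is a blocking factor of $\mathcal{A}$ if every positional word $\mu$ having $\tau$ as a factor satisfies $\mu\notin\widehat L(\mathcal{A})$. -}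

module Defs where

open import Data.Nat using (ℕ; zero; suc; NonZero; _+_)
open import Data.Nat.Divisibility using (_∣_)
open import Data.Nat.DivMod using (_mod_; _%_)
open import Data.Fin using (Fin; toℕ)
open import Data.Bool using (Bool; true)
open import Data.List using (List; []; _∷_; _++_; length)
open import Data.Product using (Σ; _×_; _,_; ∃; ∃-syntax)
open import Relation.Binary.PropositionalEquality using (_≡_)
open import Relation.Nullary using (¬_)

record NFA (n k : ℕ) : Set where
  field
    δ  : Fin n → Fin k → Fin n → Bool
    q₀ : Fin n
    F  : Fin n → Bool

module _ {n k : ℕ} (A : NFA n k) where
  open NFA A

  data Run : Fin n → List (Fin k) → Fin n → Set where
    run-ε : ∀ {p} → Run p [] p
    run-∷ : ∀ {p a q r u} → δ p a q ≡ true → Run q u r → Run p (a ∷ u) r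

  Accepts : List (Fin k) → Set
  Accepts u = ∃[ f ] (Run q₀ u f × F f ≡ true)

  Trim : Set
  Trim = ∀ q → (∃[ u ] Run q₀ u q) × (∃[ u ] ∃[ f ] (Run q u f × F f ≡ true))

  -- underlying graph strongly connected (paths of the graph = runs on some word)
  StronglyConnected : Set
  StronglyConnected = ∀ p q → ∃[ u ] Run p u q

  CycleLength : ℕ → Set
  CycleLength ℓ = ∃[ q ] ∃[ u ] (Run q u q × length u ≡ ℓ)

  IsPeriod : ℕ → Set
  IsPeriod per = (∀ ℓ → CycleLength ℓ → per ∣ ℓ)
               × (∀ d → (∀ ℓ → CycleLength ℓ → d ∣ ℓ) → d ∣ per)

  -- cls q = i means q ∈ Q_i.  Every path from Q_i to Q_j has length
  -- ≡ j - i (mod per), and q₀ ∈ Q_0.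
  IsPeriodicityClasses : (per : ℕ) .{{_ : NonZero per}} → (Fin n → Fin per) → Set
  IsPeriodicityClasses per cls =
    (∀ p u q → Run p u q → (toℕ (cls p) + length u) % per ≡ toℕ (cls q))
    × toℕ (cls q₀) ≡ 0

⟨_∶_⟩ : {k per : ℕ} .{{_ : NonZero per}} → ℕ → List (Fin k) → List (Fin per × Fin k)
⟨ m ∶ [] ⟩ = []
⟨_∶_⟩ {per = per} m (a ∷ u) = (m mod per , a) ∷ ⟨ suc m ∶ u ⟩

IsPositional : {k per : ℕ} .{{_ : NonZero per}} → List (Fin per × Fin k) → Set
IsPositional {k} μ = ∃[ m ] ∃[ u ] (μ ≡ ⟨_∶_⟩ {k} m u)

IsFactor : {A : Set} → List A → List A → Set
IsFactor {A} τ μ = Σ (List A) (λ x → Σ (List A) (λ y → μ ≡ x ++ (τ ++ y)))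

module _ {n k : ℕ} (A : NFA n k) (per : ℕ) .{{_ : NonZero per}} where

  InPosLang : List (Fin per × Fin k) → Set
  InPosLang μ = ∃[ u ] (Accepts A u × μ ≡ ⟨ 0 ∶ u ⟩)

  BlockingFactor : List (Fin per × Fin k) → Set
  BlockingFactor τ = ∀ μ → IsPositional {k} μ → IsFactor τ μ → ¬ InPosLang μ

{-# OPTIONS --safe #-}
-- If p ∈ Q_i has a run on u to q, trimness extends it to an accepting run on v u w from q₀;
-- since q₀ ∈ Q_0, |v| ≡ i (mod λ), so ⟨i:u⟩ is a factor of ⟨0:vuw⟩ ∈ L̂(A). Conversely, an
-- occurrence of ⟨i:u⟩ (u ≠ ε) after a prefix ⟨0:w₁⟩ of ⟨0:w⟩ ∈ L̂(A) cuts the accepting run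
-- at a state reached after |w₁| ≡ i letters, i.e. in Q_i, from which u is read. For u = ε the
-- class Q_i must be shown nonempty: A has a transition (otherwise λ could not be the gcd of the
-- cycle lengths), hence by strong connectivity runs from q₀ of every length.
module Submission where

open import Defs
open import Data.Nat using (ℕ; NonZero; zero; suc; _+_)
open import Data.Nat.Properties using (+-identityʳ; +-suc; n<1+n)
open import Data.Nat.DivMod using (_mod_; _%_; %-distribˡ-+; m%n<n; m<n⇒m%n≡m)
open import Data.Nat.Divisibility using (_∣_; _∣0; >⇒∤)
open import Data.Fin using (Fin; toℕ)
open import Data.Fin.Properties using (toℕ-injective; toℕ-fromℕ<; toℕ<n; any?)
open import Data.Bool using (true)
open import Data.Bool.Properties using () renaming (_≟_ to _≟ᵇ_)
open import Data.List using (List; []; _∷_; _++_; length; map)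
open import Data.List.Properties using (∷-injective)
open import Data.Product using (_×_; _,_; ∃-syntax; proj₁; proj₂)
open import Data.Empty using (⊥-elim)
open import Relation.Binary.PropositionalEquality
  using (_≡_; refl; sym; trans; cong; cong₂; module ≡-Reasoning)
open import Relation.Nullary using (¬_; Dec; yes; no)
open import Function.Bundles using (_⇔_; mk⇔)

module _ {n k : ℕ} (A : NFA n k) where
  open NFA A

  run-++ : ∀ {p v q w r} → Run A p v q → Run A q w r → Run A p (v ++ w) r
  run-++ run-ε       ρ = ρ
  run-++ (run-∷ e σ) ρ = run-∷ e (run-++ σ ρ)

  run-++⁻ : ∀ {p} v {w r} → Run A p (v ++ w) r → ∃[ q ] (Run A p v q × Run A q w r)
  run-++⁻ []      ρ           = _ , run-ε , ρ
  run-++⁻ (a ∷ v) (run-∷ e ρ) with run-++⁻ v ρ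
  ... | q , σ , τ = q , run-∷ e σ , τ

  HasTransitionFrom : Fin n → Set
  HasTransitionFrom p = ∃[ a ] ∃[ q ] δ p a q ≡ true

  HasTransition : Set
  HasTransition = ∃[ p ] HasTransitionFrom p

  hasTransition? : Dec HasTransition
  hasTransition? = any? λ p → any? λ a → any? λ q → δ p a q ≟ᵇ true

  ¬hasTransition⇒word≡[] : ¬ HasTransition → ∀ {p u q} → Run A p u q → u ≡ []
  ¬hasTransition⇒word≡[] _  run-ε       = refl
  ¬hasTransition⇒word≡[] ¬t (run-∷ e _) = ⊥-elim (¬t (_ , _ , _ , e))

  period⇒hasTransition : ∀ {per} .{{_ : NonZero per}} → IsPeriod A per → HasTransition
  period⇒hasTransition {per} (_ , greatest) with hasTransition?
  ... | yes t = t
  ... | no ¬t = ⊥-elim (>⇒∤ (n<1+n per) (greatest (suc per) divides-cycles))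
    where
    divides-cycles : ∀ ℓ → CycleLength A ℓ → suc per ∣ ℓ
    divides-cycles _ (_ , _ , ρ , refl) rewrite ¬hasTransition⇒word≡[] ¬t ρ = suc per ∣0

  stronglyConnected⇒hasTransitionFrom :
    StronglyConnected A → HasTransition → ∀ s → HasTransitionFrom s
  stronglyConnected⇒hasTransitionFrom sc (p , t) s with sc s p
  ... | _ , run-ε       = t
  ... | _ , run-∷ e _   = _ , _ , e

  run-of-length : (∀ s → HasTransitionFrom s) →
                  ∀ N s → ∃[ v ] ∃[ r ] (Run A s v r × length v ≡ N)
  run-of-length out zero    s = [] , s , run-ε , refl
  run-of-length out (suc N) s with out s
  ... | a , q , e with run-of-length out N q
  ... | v , r , ρ , refl = a ∷ v , r , run-∷ e ρ , refl

module _ {per : ℕ} .{{_ : NonZero per}} where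
  open ≡-Reasoning

  toℕ-mod : ∀ m → toℕ (m mod per) ≡ m % per
  toℕ-mod m = toℕ-fromℕ< (m%n<n m per)

  mod-toℕ : (j : Fin per) → toℕ j mod per ≡ j
  mod-toℕ j = toℕ-injective (trans (toℕ-mod (toℕ j)) (m<n⇒m%n≡m (toℕ<n j)))

  mod≡⇒%≡ : ∀ {m m'} → m mod per ≡ m' mod per → m % per ≡ m' % per
  mod≡⇒%≡ {m} {m'} e = trans (sym (toℕ-mod m)) (trans (cong toℕ e) (toℕ-mod m'))

  %≡⇒mod≡ : ∀ {m m'} → m % per ≡ m' % per → m mod per ≡ m' mod per
  %≡⇒mod≡ {m} {m'} e = toℕ-injective (trans (toℕ-mod m) (trans e (sym (toℕ-mod m'))))

  suc-mod-cong : ∀ {m m'} → m mod per ≡ m' mod per → suc m mod per ≡ suc m' mod per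
  suc-mod-cong {m} {m'} e = %≡⇒mod≡ (begin
    (1 + m) % per                ≡⟨ %-distribˡ-+ 1 m per ⟩
    (1 % per + m % per) % per    ≡⟨ cong (λ r → (1 % per + r) % per) (mod≡⇒%≡ e) ⟩
    (1 % per + m' % per) % per   ≡⟨ %-distribˡ-+ 1 m' per ⟨
    (1 + m') % per               ∎)

  ⟨⟩-cong : ∀ {k m m'} (u : List (Fin k)) → m mod per ≡ m' mod per → ⟨ m ∶ u ⟩ ≡ ⟨ m' ∶ u ⟩
  ⟨⟩-cong []      e = refl
  ⟨⟩-cong (a ∷ u) e = cong₂ _∷_ (cong (_, a) e) (⟨⟩-cong u (suc-mod-cong e))

  ⟨⟩-++ : ∀ {k} m (u v : List (Fin k)) → ⟨ m ∶ u ++ v ⟩ ≡ ⟨ m ∶ u ⟩ ++ ⟨ m + length u ∶ v ⟩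
  ⟨⟩-++ m []      v rewrite +-identityʳ m = refl
  ⟨⟩-++ m (a ∷ u) v rewrite +-suc m (length u) = cong (_ ∷_) (⟨⟩-++ (suc m) u v)

  ⟨⟩-++⁻ : ∀ {k} m (x z : List (Fin per × Fin k)) {w} → x ++ z ≡ ⟨ m ∶ w ⟩ →
           ∃[ w₁ ] ∃[ w₂ ] (w ≡ w₁ ++ w₂ × x ≡ ⟨ m ∶ w₁ ⟩ × z ≡ ⟨ m + length w₁ ∶ w₂ ⟩)
  ⟨⟩-++⁻ m [] z {w} e = [] , w , refl , refl , trans e (cong (λ j → ⟨ j ∶ w ⟩) (sym (+-identityʳ m)))
  ⟨⟩-++⁻ m (c ∷ x) z {b ∷ w} e with ∷-injective e
  ... | refl , e′ with ⟨⟩-++⁻ (suc m) x z e′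
  ... | w₁ , w₂ , refl , refl , refl =
    b ∷ w₁ , w₂ , refl , refl , cong (λ j → ⟨ j ∶ w₂ ⟩) (sym (+-suc m (length w₁)))

  labels-⟨⟩ : ∀ {k} m (u : List (Fin k)) → map proj₂ ⟨ m ∶ u ⟩ ≡ u
  labels-⟨⟩ m []      = refl
  labels-⟨⟩ m (a ∷ u) = cong (a ∷_) (labels-⟨⟩ (suc m) u)

  ⟨⟩-injectiveʳ : ∀ {k i m} {u v : List (Fin k)} → ⟨ i ∶ u ⟩ ≡ ⟨ m ∶ v ⟩ → u ≡ v
  ⟨⟩-injectiveʳ {i = i} {m} {u} {v} e =
    trans (sym (labels-⟨⟩ i u)) (trans (cong (map proj₂) e) (labels-⟨⟩ m v))

  ⟨⟩-injectiveˡ : ∀ {k i m} {a : Fin k} {u v} → ⟨ i ∶ a ∷ u ⟩ ≡ ⟨ m ∶ v ⟩ → i mod per ≡ m mod per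
  ⟨⟩-injectiveˡ {v = _ ∷ _} e = cong proj₁ (proj₁ (∷-injective e))

module _ {n k : ℕ} (A : NFA n k) {per : ℕ} .{{_ : NonZero per}} {cls : Fin n → Fin per}
         (classes : IsPeriodicityClasses A per cls) where
  open NFA A
  open ≡-Reasoning

  cls-after : ∀ {v p} → Run A q₀ v p → cls p ≡ length v mod per
  cls-after {v} {p} ρ = toℕ-injective (begin
    toℕ (cls p)                       ≡⟨ proj₁ classes q₀ v p ρ ⟨
    (toℕ (cls q₀) + length v) % per   ≡⟨ cong (λ c → (c + length v) % per) (proj₂ classes) ⟩
    length v % per                    ≡⟨ toℕ-mod (length v) ⟨
    toℕ (length v mod per)            ∎)

  class-inhabited : (∀ s → HasTransitionFrom A s) → ∀ j → ∃[ p ] cls p ≡ j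
  class-inhabited out j with run-of-length A out (toℕ j) q₀
  ... | _ , p , ρ , |v|≡j = p , trans (cls-after ρ) (trans (cong (_mod per) |v|≡j) (mod-toℕ j))

  run⇒accepted-factor : Trim A → ∀ i {p u q} → cls p ≡ i mod per → Run A p u q →
                        ∃[ w ] (Accepts A w × IsFactor ⟨ i ∶ u ⟩ ⟨ 0 ∶ w ⟩)
  run⇒accepted-factor trim i {p} {u} {q} p∈Qᵢ ρ with proj₁ (trim p) | proj₂ (trim q)
  ... | v , σ | w , f , τ , f∈F =
    v ++ (u ++ w) , (f , run-++ A σ (run-++ A ρ τ) , f∈F) ,
    ⟨ 0 ∶ v ⟩ , ⟨ length v + length u ∶ w ⟩ , splitting
    where
    splitting : ⟨ 0 ∶ v ++ (u ++ w) ⟩ ≡ ⟨ 0 ∶ v ⟩ ++ (⟨ i ∶ u ⟩ ++ ⟨ length v + length u ∶ w ⟩)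
    splitting = begin
      ⟨ 0 ∶ v ++ (u ++ w) ⟩
        ≡⟨ ⟨⟩-++ 0 v (u ++ w) ⟩
      ⟨ 0 ∶ v ⟩ ++ ⟨ length v ∶ u ++ w ⟩
        ≡⟨ cong (⟨ 0 ∶ v ⟩ ++_) (⟨⟩-++ (length v) u w) ⟩
      ⟨ 0 ∶ v ⟩ ++ (⟨ length v ∶ u ⟩ ++ ⟨ length v + length u ∶ w ⟩)
        ≡⟨ cong (λ t → ⟨ 0 ∶ v ⟩ ++ (t ++ ⟨ length v + length u ∶ w ⟩))
                (⟨⟩-cong u (trans (sym (cls-after σ)) p∈Qᵢ)) ⟩
      ⟨ 0 ∶ v ⟩ ++ (⟨ i ∶ u ⟩ ++ ⟨ length v + length u ∶ w ⟩) ∎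

  accepted-factor⇒run : ∀ i a u {w} → Accepts A w → IsFactor ⟨ i ∶ a ∷ u ⟩ ⟨ 0 ∶ w ⟩ →
                        ∃[ p ] ∃[ q ] (cls p ≡ i mod per × Run A p (a ∷ u) q)
  accepted-factor⇒run i a u (f , ρ , _) (x , y , e)
    with ⟨⟩-++⁻ 0 x (⟨ i ∶ a ∷ u ⟩ ++ y) (sym e)
  ... | w₁ , w₂ , refl , _ , e₂ with ⟨⟩-++⁻ (length w₁) ⟨ i ∶ a ∷ u ⟩ y e₂
  ... | w₃ , _ , refl , e₃ , _ with ⟨⟩-injectiveʳ e₃
  ... | refl with run-++⁻ A w₁ ρ
  ... | p , σ , τ with run-++⁻ A (a ∷ u) τ
  ... | q , ρᵤ , _ = p , q , trans (cls-after σ) (sym (⟨⟩-injectiveˡ e₃)) , ρᵤ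

lemma15 : {n k : ℕ} (A : NFA n k) → Trim A → StronglyConnected A →
          (per : ℕ) .{{_ : NonZero per}} → IsPeriod A per →
          (cls : Fin n → Fin per) → IsPeriodicityClasses A per cls →
          (i : ℕ) (u : List (Fin k)) →
          BlockingFactor A per ⟨ i ∶ u ⟩
            ⇔ (∀ (p q : Fin n) → cls p ≡ i mod per → ¬ Run A p u q)
lemma15 A trim sc per period cls classes i u = mk⇔ blocking⇒noRun (noRun⇒blocking u)
  where
  blocking⇒noRun : BlockingFactor A per ⟨ i ∶ u ⟩ → ∀ p q → cls p ≡ i mod per → ¬ Run A p u q
  blocking⇒noRun blocking p q p∈Qᵢ ρ with run⇒accepted-factor A classes trim i p∈Qᵢ ρ
  ... | w , accepted , factor = blocking ⟨ 0 ∶ w ⟩ (0 , w , refl) factor (w , accepted , refl)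

  noRun⇒blocking : ∀ u → (∀ p q → cls p ≡ i mod per → ¬ Run A p u q) → BlockingFactor A per ⟨ i ∶ u ⟩
  noRun⇒blocking [] noRun _ _ _ _
    with class-inhabited A classes
           (stronglyConnected⇒hasTransitionFrom A sc (period⇒hasTransition A period)) (i mod per)
  ... | p , p∈Qᵢ = noRun p p p∈Qᵢ run-ε
  noRun⇒blocking (a ∷ u) noRun _ _ factor (w , accepted , refl)
    with accepted-factor⇒run A classes i a u accepted factor
  ... | p , q , p∈Qᵢ , ρ = noRun p q p∈Qᵢ ρ
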